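{- Let $G$ be a group. For all gradual subgroups $\sigma_1,\sigma_2$ of $G$: (1) $\sigma_1\subseteq\sigma_1^c$; (2) $\sigma_1^c=\sigma_1^{cc}$; (3) if $\sigma_1\subseteq\sigma_2$ then $\sigma_1^c\subseteq\sigma_2^c$; (4) $\sigma_1^c$ is the smallest decreasing gradual subgroup containing $\sigma_1$; (5) if $\sigma_1$ is normal, then $\sigma_1^c$ is normal, and for every $\alpha\in(0,1]$, $\sigma_1^c(\alpha)$ is the set of all finite products of elements of $\bigcup\{\sigma_1(\beta)\mid\beta\geq\alpha\}$; (6) if $\sigma_1$ or $\sigma_2$ is normal, then $(\sigma_1\sigma_2)^c=\sigma_1^c\sigma_2^c$.
   Context: A gradual subgroup of $G$ is a map $\sigma$ from $(0,1]$ to the set of subgroups of $G$; it is normal if each $\sigma(\alpha)$ is a normal subgroup, and decreasing if $\sigma(\beta)\subseteq\sigma(\alpha)$ whenever $\alpha\leq\beta$. $\sigma_1\subseteq\sigma_2$ means $\sigma_1(\alpha)\subseteq\sigma_2(\alpha)$ for all $\alpha$, and $(\sigma_1\sigma_2)(\alpha)=\sigma_1(\alpha)\sigma_2(\alpha)$ (a gradual subgroup when one of them is normal). The accumulation is $\sigma^c(\alpha)=\langle\bigcup\{\sigma(\beta)\mid\alpha\leq\beta\leq1\}\rangle$, the subgroup generated. -}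

module Defs where

open import Level using (Level; _⊔_; 0ℓ) renaming (suc to lsuc)
open import Algebra.Bundles using (Group)
open import Relation.Binary.Bundles using (TotalOrder)
open import Data.Product using (Σ; ∃; ∃₂; _×_; _,_)
open import Data.List using (List; foldr)
open import Data.List.Relation.Unary.All using (All)

module _ {c ℓ : Level} (G : Group c ℓ) where
  open Group G

  SubsetG : Set (lsuc (c ⊔ ℓ))
  SubsetG = Carrier → Set (c ⊔ ℓ)

  _⊆ₛ_ : SubsetG → SubsetG → Set (c ⊔ ℓ)
  P ⊆ₛ Q = ∀ {x} → P x → Q x

  record IsSubgroup (P : SubsetG) : Set (c ⊔ ℓ) where
    field
      resp : ∀ {x y} → x ≈ y → P x → P y
      ε∈   : P ε
      ∙∈   : ∀ {x y} → P x → P y → P (x ∙ y)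
      ⁻¹∈  : ∀ {x} → P x → P (x ⁻¹)

  IsNormalSubset : SubsetG → Set (c ⊔ ℓ)
  IsNormalSubset P = ∀ g {x} → P x → P ((g ∙ x) ∙ g ⁻¹)

  data Gen (P : SubsetG) : Carrier → Set (c ⊔ ℓ) where
    gen  : ∀ {x} → P x → Gen P x
    genε : Gen P ε
    gen∙ : ∀ {x y} → Gen P x → Gen P y → Gen P (x ∙ y)
    gen⁻¹ : ∀ {x} → Gen P x → Gen P (x ⁻¹)
    genResp : ∀ {x y} → x ≈ y → Gen P x → Gen P y

  Gen-isSubgroup : (P : SubsetG) → IsSubgroup (Gen P)
  Gen-isSubgroup P = record { resp = genResp ; ε∈ = genε ; ∙∈ = gen∙ ; ⁻¹∈ = gen⁻¹ }

  ProdSubset : SubsetG → SubsetG → SubsetG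
  ProdSubset P Q x = ∃₂ λ a b → P a × Q b × x ≈ a ∙ b

  FinProducts : SubsetG → SubsetG
  FinProducts P x = Σ (List Carrier) λ xs → All P xs × x ≈ foldr _∙_ ε xs

-- Gradual subgroups indexed by a totally ordered set I (stands for (0,1]).
module _ {c ℓ : Level} (G : Group c ℓ) (I : TotalOrder 0ℓ 0ℓ 0ℓ) where
  open Group G
  open TotalOrder I renaming (Carrier to Idx; _≤_ to _≤ᵢ_; _≈_ to _≈ᵢ_)

  Family : Set (lsuc (c ⊔ ℓ))
  Family = Idx → SubsetG G

  record GradualSubgroup : Set (lsuc (c ⊔ ℓ)) where
    field
      at    : Family
      isSub : ∀ α → IsSubgroup G (at α)
  open GradualSubgroup public

  _⊆ᵍ_ : Family → Family → Set (c ⊔ ℓ)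
  σ ⊆ᵍ τ = ∀ α → _⊆ₛ_ G (σ α) (τ α)

  _≐ᵍ_ : Family → Family → Set (c ⊔ ℓ)
  σ ≐ᵍ τ = (σ ⊆ᵍ τ) × (τ ⊆ᵍ σ)

  Decreasing : Family → Set (c ⊔ ℓ)
  Decreasing σ = ∀ {α β} → α ≤ᵢ β → _⊆ₛ_ G (σ β) (σ α)

  NormalG : Family → Set (c ⊔ ℓ)
  NormalG σ = ∀ α → IsNormalSubset G (σ α)

  UpUnion : Family → Idx → SubsetG G
  UpUnion σ α x = Σ Idx λ β → (α ≤ᵢ β) × σ β x

  accF : Family → Family
  accF σ α = Gen G (UpUnion σ α)

  acc : GradualSubgroup → GradualSubgroup
  acc σ = record { at = accF (at σ) ; isSub = λ α → Gen-isSubgroup G (UpUnion (at σ) α) }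

  prodF : Family → Family → Family
  prodF σ τ α = ProdSubset G (σ α) (τ α)

module Submission where

-- The accumulation σᶜ(α) = ⟨⋃_{β ≥ α} σ(β)⟩ is the subgroup generated by an
-- upward union, so everything follows from three facts about generated
-- subgroups (monotone in the generators, least subgroup containing them,
-- normal when the generators are conjugation-closed) together with two
-- classical facts of group theory:
--   * if P is closed under inverses, ⟨P⟩ is the set of finite products of
--     elements of P;
--   * if H, K are subgroups with KH ⊆ HK, then HK is a subgroup; this holds
--     in particular when H or K is normal.

open import Defs
open import Level using (0ℓ; Level; _⊔_)
open import Algebra.Bundles using (Group)
open import Relation.Binary.Bundles using (TotalOrder)
open import Data.Product using (_×_; _,_)
open import Data.Sum using (_⊎_)
import Data.Sum as Sum
open import Data.List using (List; []; _∷_; _++_; foldr; [_])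
open import Data.List.Relation.Unary.All using (All; []; _∷_)
open import Data.List.Relation.Unary.All.Properties using (++⁺)
import Algebra.Properties.Group as GroupProperties
import Relation.Binary.Reasoning.Setoid as SetoidReasoning

module Subgroups {c ℓ : Level} (G : Group c ℓ) where
  open Group G
  open GroupProperties G
  open SetoidReasoning setoid

  conj : Carrier → Carrier → Carrier
  conj g x = (g ∙ x) ∙ g ⁻¹

  conj-ε : ∀ g → conj g ε ≈ ε
  conj-ε g = trans (∙-congʳ (identityʳ g)) (inverseʳ g)

  conj-∙ : ∀ g x y → conj g (x ∙ y) ≈ conj g x ∙ conj g y
  conj-∙ g x y = sym (begin
    ((g ∙ x) ∙ g ⁻¹) ∙ ((g ∙ y) ∙ g ⁻¹) ≈⟨ assoc (g ∙ x) (g ⁻¹) _ ⟩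
    (g ∙ x) ∙ (g ⁻¹ ∙ ((g ∙ y) ∙ g ⁻¹)) ≈⟨ ∙-congˡ (∙-congˡ (assoc g y (g ⁻¹))) ⟩
    (g ∙ x) ∙ (g ⁻¹ ∙ (g ∙ (y ∙ g ⁻¹))) ≈⟨ ∙-congˡ (\\-leftDividesʳ g _) ⟩
    (g ∙ x) ∙ (y ∙ g ⁻¹)                 ≈⟨ assoc g x _ ⟩
    g ∙ (x ∙ (y ∙ g ⁻¹))                 ≈⟨ ∙-congˡ (assoc x y (g ⁻¹)) ⟨
    g ∙ ((x ∙ y) ∙ g ⁻¹)                 ≈⟨ assoc g (x ∙ y) (g ⁻¹) ⟨
    (g ∙ (x ∙ y)) ∙ g ⁻¹                 ∎)

  conj-⁻¹ : ∀ g x → conj g (x ⁻¹) ≈ conj g x ⁻¹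
  conj-⁻¹ g x = sym (begin
    ((g ∙ x) ∙ g ⁻¹) ⁻¹    ≈⟨ ⁻¹-anti-homo-∙ (g ∙ x) (g ⁻¹) ⟩
    g ⁻¹ ⁻¹ ∙ (g ∙ x) ⁻¹   ≈⟨ ∙-cong (⁻¹-involutive g) (⁻¹-anti-homo-∙ g x) ⟩
    g ∙ (x ⁻¹ ∙ g ⁻¹)      ≈⟨ assoc g (x ⁻¹) (g ⁻¹) ⟨
    (g ∙ x ⁻¹) ∙ g ⁻¹      ∎)

  conj-cong : ∀ g {x y} → x ≈ y → conj g x ≈ conj g y
  conj-cong g x≈y = ∙-congʳ (∙-congˡ x≈y)

  slideˡ : ∀ x y → x ∙ y ≈ y ∙ conj (y ⁻¹) x
  slideˡ x y = begin
    x ∙ y                        ≈⟨ \\-leftDividesˡ y (x ∙ y) ⟨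
    y ∙ (y ⁻¹ ∙ (x ∙ y))         ≈⟨ ∙-congˡ (assoc (y ⁻¹) x y) ⟨
    y ∙ ((y ⁻¹ ∙ x) ∙ y)         ≈⟨ ∙-congˡ (∙-congˡ (⁻¹-involutive y)) ⟨
    y ∙ ((y ⁻¹ ∙ x) ∙ y ⁻¹ ⁻¹)   ∎

  slideʳ : ∀ x y → x ∙ y ≈ conj x y ∙ x
  slideʳ x y = sym (//-rightDividesˡ x (x ∙ y))

  Gen-mono : ∀ {P Q : SubsetG G} → _⊆ₛ_ G P Q → _⊆ₛ_ G (Gen G P) (Gen G Q)
  Gen-mono P⊆Q (gen p)       = gen (P⊆Q p)
  Gen-mono P⊆Q genε          = genε
  Gen-mono P⊆Q (gen∙ x y)    = gen∙ (Gen-mono P⊆Q x) (Gen-mono P⊆Q y)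
  Gen-mono P⊆Q (gen⁻¹ x)     = gen⁻¹ (Gen-mono P⊆Q x)
  Gen-mono P⊆Q (genResp e x) = genResp e (Gen-mono P⊆Q x)

  Gen-least : ∀ {P Q : SubsetG G} → IsSubgroup G Q → _⊆ₛ_ G P Q → _⊆ₛ_ G (Gen G P) Q
  Gen-least Q-sub P⊆Q (gen p)       = P⊆Q p
  Gen-least Q-sub P⊆Q genε          = IsSubgroup.ε∈ Q-sub
  Gen-least Q-sub P⊆Q (gen∙ x y)    = IsSubgroup.∙∈ Q-sub (Gen-least Q-sub P⊆Q x) (Gen-least Q-sub P⊆Q y)
  Gen-least Q-sub P⊆Q (gen⁻¹ x)     = IsSubgroup.⁻¹∈ Q-sub (Gen-least Q-sub P⊆Q x)
  Gen-least Q-sub P⊆Q (genResp e x) = IsSubgroup.resp Q-sub e (Gen-least Q-sub P⊆Q x)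

  Gen-normal : ∀ {P : SubsetG G} → IsNormalSubset G P → IsNormalSubset G (Gen G P)
  Gen-normal P-nrm g (gen p)       = gen (P-nrm g p)
  Gen-normal P-nrm g genε          = genResp (sym (conj-ε g)) genε
  Gen-normal P-nrm g (gen∙ x y)    = genResp (sym (conj-∙ g _ _)) (gen∙ (Gen-normal P-nrm g x) (Gen-normal P-nrm g y))
  Gen-normal P-nrm g (gen⁻¹ x)     = genResp (sym (conj-⁻¹ g _)) (gen⁻¹ (Gen-normal P-nrm g x))
  Gen-normal P-nrm g (genResp e x) = genResp (conj-cong g e) (Gen-normal P-nrm g x)

  product : List Carrier → Carrier
  product = foldr _∙_ ε

  product-++ : ∀ xs ys → product (xs ++ ys) ≈ product xs ∙ product ys
  product-++ []       ys = sym (identityˡ _)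
  product-++ (x ∷ xs) ys = trans (∙-congˡ (product-++ xs ys)) (sym (assoc x _ _))

  inverses : List Carrier → List Carrier
  inverses []       = []
  inverses (x ∷ xs) = inverses xs ++ [ x ⁻¹ ]

  inverses-All : ∀ {P : SubsetG G} → (∀ {x} → P x → P (x ⁻¹)) →
                 ∀ {xs} → All P xs → All P (inverses xs)
  inverses-All P-inv []       = []
  inverses-All P-inv (p ∷ ps) = ++⁺ (inverses-All P-inv ps) (P-inv p ∷ [])

  product-inverses : ∀ xs → product xs ⁻¹ ≈ product (inverses xs)
  product-inverses []       = ε⁻¹≈ε
  product-inverses (x ∷ xs) = begin
    (x ∙ product xs) ⁻¹                 ≈⟨ ⁻¹-anti-homo-∙ x (product xs) ⟩
    product xs ⁻¹ ∙ x ⁻¹                ≈⟨ ∙-cong (product-inverses xs) (sym (identityʳ (x ⁻¹))) ⟩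
    product (inverses xs) ∙ (x ⁻¹ ∙ ε)  ≈⟨ product-++ (inverses xs) [ x ⁻¹ ] ⟨
    product (inverses xs ++ [ x ⁻¹ ])   ∎

  FinProducts-isSubgroup : ∀ {P : SubsetG G} → (∀ {x} → P x → P (x ⁻¹)) →
                           IsSubgroup G (FinProducts G P)
  FinProducts-isSubgroup P-inv = record
    { resp = λ { x≈y (xs , ps , x≈∏) → xs , ps , trans (sym x≈y) x≈∏ }
    ; ε∈   = [] , [] , refl
    ; ∙∈   = λ { (xs , ps , x≈∏) (ys , qs , y≈∏) →
                 xs ++ ys , ++⁺ ps qs , trans (∙-cong x≈∏ y≈∏) (sym (product-++ xs ys)) }
    ; ⁻¹∈  = λ { (xs , ps , x≈∏) →
                 inverses xs , inverses-All P-inv ps , trans (⁻¹-cong x≈∏) (product-inverses xs) }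
    }

  Gen⊆FinProducts : ∀ {P : SubsetG G} → (∀ {x} → P x → P (x ⁻¹)) →
                    _⊆ₛ_ G (Gen G P) (FinProducts G P)
  Gen⊆FinProducts P-inv =
    Gen-least (FinProducts-isSubgroup P-inv) (λ {x} p → x ∷ [] , p ∷ [] , sym (identityʳ x))

  FinProducts⊆Gen : ∀ {P : SubsetG G} → _⊆ₛ_ G (FinProducts G P) (Gen G P)
  FinProducts⊆Gen {P} (xs , ps , x≈∏) = genResp (sym x≈∏) (product∈Gen ps)
    where
    product∈Gen : ∀ {xs} → All P xs → Gen G P (product xs)
    product∈Gen []       = genε
    product∈Gen (p ∷ ps) = gen∙ (gen p) (product∈Gen ps)

  ⊆-ProdSubsetˡ : ∀ {H K : SubsetG G} → K ε → _⊆ₛ_ G H (ProdSubset G H K)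
  ⊆-ProdSubsetˡ ε∈K {x} h = x , ε , h , ε∈K , sym (identityʳ x)

  ⊆-ProdSubsetʳ : ∀ {H K : SubsetG G} → H ε → _⊆ₛ_ G K (ProdSubset G H K)
  ⊆-ProdSubsetʳ ε∈H {x} k = ε , x , ε∈H , k , sym (identityˡ x)

  Commutes : SubsetG G → SubsetG G → Set (c ⊔ ℓ)
  Commutes H K = ∀ {h k} → H h → K k → ProdSubset G H K (k ∙ h)

  ProdSubset-isSubgroup : ∀ {H K : SubsetG G} → IsSubgroup G H → IsSubgroup G K →
                          Commutes H K → IsSubgroup G (ProdSubset G H K)
  ProdSubset-isSubgroup {H} {K} H-sub K-sub KH⊆HK = record
    { resp = λ { x≈y (a , b , ha , kb , x≈ab) → a , b , ha , kb , trans (sym x≈y) x≈ab }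
    ; ε∈   = ⊆-ProdSubsetˡ K.ε∈ H.ε∈
    ; ∙∈   = closed-∙
    ; ⁻¹∈  = closed-⁻¹
    }
    where
    module H = IsSubgroup H-sub
    module K = IsSubgroup K-sub

    -- (a ∙ b)(a' ∙ b') = (a ∙ u)(v ∙ b') where b ∙ a' = u ∙ v.
    closed-∙ : ∀ {x y} → ProdSubset G H K x → ProdSubset G H K y → ProdSubset G H K (x ∙ y)
    closed-∙ {x} {y} (a , b , ha , kb , x≈ab) (a' , b' , ha' , kb' , y≈a'b')
      with KH⊆HK ha' kb
    ... | u , v , hu , kv , ba'≈uv = a ∙ u , v ∙ b' , H.∙∈ ha hu , K.∙∈ kv kb' , (begin
      x ∙ y                ≈⟨ ∙-cong x≈ab y≈a'b' ⟩
      (a ∙ b) ∙ (a' ∙ b')  ≈⟨ assoc a b _ ⟩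
      a ∙ (b ∙ (a' ∙ b'))  ≈⟨ ∙-congˡ (assoc b a' b') ⟨
      a ∙ ((b ∙ a') ∙ b')  ≈⟨ ∙-congˡ (∙-congʳ ba'≈uv) ⟩
      a ∙ ((u ∙ v) ∙ b')   ≈⟨ ∙-congˡ (assoc u v b') ⟩
      a ∙ (u ∙ (v ∙ b'))   ≈⟨ assoc a u _ ⟨
      (a ∙ u) ∙ (v ∙ b')   ∎)

    -- (a ∙ b)⁻¹ = b⁻¹ ∙ a⁻¹ lies in KH ⊆ HK.
    closed-⁻¹ : ∀ {x} → ProdSubset G H K x → ProdSubset G H K (x ⁻¹)
    closed-⁻¹ {x} (a , b , ha , kb , x≈ab)
      with KH⊆HK (H.⁻¹∈ ha) (K.⁻¹∈ kb)
    ... | u , v , hu , kv , b⁻¹a⁻¹≈uv =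
      u , v , hu , kv , trans (⁻¹-cong x≈ab) (trans (⁻¹-anti-homo-∙ a b) b⁻¹a⁻¹≈uv)

  -- KH ⊆ HK holds when K is normal (k h = h (h⁻¹ k h)) ...
  Commutes-normalʳ : ∀ {H K : SubsetG G} → IsNormalSubset G K → Commutes H K
  Commutes-normalʳ K-nrm {h} {k} hh kk = h , conj (h ⁻¹) k , hh , K-nrm (h ⁻¹) kk , slideˡ k h

  -- ... and when H is normal (k h = (k h k⁻¹) k).
  Commutes-normalˡ : ∀ {H K : SubsetG G} → IsNormalSubset G H → Commutes H K
  Commutes-normalˡ H-nrm {h} {k} hh kk = conj k h , k , H-nrm k hh , kk , slideʳ k h

module Accumulation {c ℓ : Level} (G : Group c ℓ) (I : TotalOrder 0ℓ 0ℓ 0ℓ) where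
  open Group G
  open TotalOrder I renaming (_≤_ to _≤ᵢ_; refl to ≤ᵢ-refl; trans to ≤ᵢ-trans)
  open Subgroups G

  UpUnion-antitone : ∀ (σ : Family G I) {α β} → α ≤ᵢ β →
                     _⊆ₛ_ G (UpUnion G I σ β) (UpUnion G I σ α)
  UpUnion-antitone σ α≤β (γ , β≤γ , x) = γ , ≤ᵢ-trans α≤β β≤γ , x

  acc-extensive : ∀ (σ : Family G I) → _⊆ᵍ_ G I σ (accF G I σ)
  acc-extensive σ α x = gen (α , ≤ᵢ-refl , x)

  acc-decreasing : ∀ (σ : Family G I) → Decreasing G I (accF G I σ)
  acc-decreasing σ α≤β = Gen-mono (UpUnion-antitone σ α≤β)

  acc-mono : ∀ {σ τ : Family G I} → _⊆ᵍ_ G I σ τ → _⊆ᵍ_ G I (accF G I σ) (accF G I τ)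
  acc-mono σ⊆τ α = Gen-mono λ { (β , α≤β , x) → β , α≤β , σ⊆τ β x }

  acc-least : ∀ {σ τ : Family G I} → (∀ α → IsSubgroup G (τ α)) → Decreasing G I τ →
              _⊆ᵍ_ G I σ τ → _⊆ᵍ_ G I (accF G I σ) τ
  acc-least τ-sub τ-dec σ⊆τ α = Gen-least (τ-sub α) λ { (β , α≤β , x) → τ-dec α≤β (σ⊆τ β x) }

  -- (2) σᶜ = σᶜᶜ: σᶜ is itself a decreasing family of subgroups containing σᶜ.
  acc-idempotent : ∀ (σ : Family G I) → _≐ᵍ_ G I (accF G I σ) (accF G I (accF G I σ))
  acc-idempotent σ =
    acc-extensive (accF G I σ) ,
    acc-least (λ α → Gen-isSubgroup G _) (acc-decreasing σ) (λ α x → x)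

  acc-normal : ∀ {σ : Family G I} → NormalG G I σ → NormalG G I (accF G I σ)
  acc-normal σ-nrm α = Gen-normal λ { g (β , α≤β , x) → β , α≤β , σ-nrm β g x }

  -- (5b) σᶜ(α) consists of the finite products of elements of ⋃_{β ≥ α} σ(β).
  acc≐FinProducts : ∀ (σ : GradualSubgroup G I) →
    _≐ᵍ_ G I (accF G I (at σ)) (λ α → FinProducts G (UpUnion G I (at σ) α))
  acc≐FinProducts σ =
    (λ α → Gen⊆FinProducts λ { (β , α≤β , x) → β , α≤β , IsSubgroup.⁻¹∈ (isSub σ β) x }) ,
    (λ α → FinProducts⊆Gen)

  acc-prod : ∀ (σ₁ σ₂ : GradualSubgroup G I) → NormalG G I (at σ₁) ⊎ NormalG G I (at σ₂) →
    _≐ᵍ_ G I (accF G I (prodF G I (at σ₁) (at σ₂)))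
             (prodF G I (accF G I (at σ₁)) (accF G I (at σ₂)))
  acc-prod σ₁ σ₂ nrm = acc-prod⊆ , prod-acc⊆
    where
    prod-acc-isSubgroup : ∀ α → IsSubgroup G (prodF G I (accF G I (at σ₁)) (accF G I (at σ₂)) α)
    prod-acc-isSubgroup α = ProdSubset-isSubgroup (Gen-isSubgroup G _) (Gen-isSubgroup G _)
      (Sum.[ (λ n → Commutes-normalˡ (acc-normal n α)) , (λ n → Commutes-normalʳ (acc-normal n α)) ] nrm)

    -- ⊆: σ₁ᶜσ₂ᶜ is a subgroup containing every generator a ∙ b of (σ₁σ₂)ᶜ(α).
    acc-prod⊆ : _⊆ᵍ_ G I (accF G I (prodF G I (at σ₁) (at σ₂)))
                         (prodF G I (accF G I (at σ₁)) (accF G I (at σ₂)))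
    acc-prod⊆ α = Gen-least (prod-acc-isSubgroup α)
      λ { (β , α≤β , (a , b , ha , kb , x≈ab)) → a , b , gen (β , α≤β , ha) , gen (β , α≤β , kb) , x≈ab }

    -- ⊇: σ₁ and σ₂ are both contained in σ₁σ₂, so σ₁ᶜ and σ₂ᶜ are in (σ₁σ₂)ᶜ.
    prod-acc⊆ : _⊆ᵍ_ G I (prodF G I (accF G I (at σ₁)) (accF G I (at σ₂)))
                         (accF G I (prodF G I (at σ₁) (at σ₂)))
    prod-acc⊆ α (a , b , ha , kb , x≈ab) = genResp (sym x≈ab) (gen∙
      (acc-mono (λ β → ⊆-ProdSubsetˡ (IsSubgroup.ε∈ (isSub σ₂ β))) α ha)
      (acc-mono (λ β → ⊆-ProdSubsetʳ (IsSubgroup.ε∈ (isSub σ₁ β))) α kb))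

mainTheorem15 : ∀ {c ℓ} (G : Group c ℓ) (I : TotalOrder 0ℓ 0ℓ 0ℓ)
    (σ₁ σ₂ : GradualSubgroup G I) →
    -- (1)
    (_⊆ᵍ_ G I (at σ₁) (accF G I (at σ₁)))
    -- (2)
    × (_≐ᵍ_ G I (accF G I (at σ₁)) (accF G I (accF G I (at σ₁))))
    -- (3)
    × (_⊆ᵍ_ G I (at σ₁) (at σ₂) → _⊆ᵍ_ G I (accF G I (at σ₁)) (accF G I (at σ₂)))
    -- (4)
    × (Decreasing G I (accF G I (at σ₁))
       × _⊆ᵍ_ G I (at σ₁) (accF G I (at σ₁))
       × (∀ (τ : GradualSubgroup G I) → Decreasing G I (at τ) → _⊆ᵍ_ G I (at σ₁) (at τ) →
           _⊆ᵍ_ G I (accF G I (at σ₁)) (at τ)))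
    -- (5)
    × (NormalG G I (at σ₁) →
        NormalG G I (accF G I (at σ₁))
        × _≐ᵍ_ G I (accF G I (at σ₁)) (λ α → FinProducts G (UpUnion G I (at σ₁) α)))
    -- (6)
    × (NormalG G I (at σ₁) ⊎ NormalG G I (at σ₂) →
        _≐ᵍ_ G I (accF G I (prodF G I (at σ₁) (at σ₂)))
                 (prodF G I (accF G I (at σ₁)) (accF G I (at σ₂))))
mainTheorem15 G I σ₁ σ₂ =
  acc-extensive (at σ₁)
  , acc-idempotent (at σ₁)
  , acc-mono
  , (acc-decreasing (at σ₁) , acc-extensive (at σ₁) , λ τ → acc-least (isSub τ))
  , (λ σ₁-nrm → acc-normal σ₁-nrm , acc≐FinProducts σ₁)
  , acc-prod σ₁ σ₂
  where open Accumulation G I
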